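{- Let $e$ be an element of a matroid $M$, and let $M'$ be the series extension of $e$ in $M$. Then $M'$ is $M$-constructed.
   Context: The series extension of $e$ in $M$ is the matroid $M'$ obtained by coextending $M$ by a new element $e'$ so that $M'/e' = M$ and $\{e,e'\}$ is a series pair of $M'$. A principal extension of a matroid $M$ into a flat $F$ is a matroid $M'$ on $E(M)\cup\{x\}$ (with $x\notin E(M)$) such that $M'\setminus x=M$ and a subset of $E(M)$ spans $x$ in $M'$ iff it spans $F$ in $M$. For a matroid $N$, a matroid is $N$-constructed if it can be obtained from $N$ by a finite sequence of the operations: relabelling elements, deletion, contraction, adding coloops, and principal extensions. -}

module Defs where

open import Data.Nat using (ℕ; suc; _≤_; _<_; _+_; _∸_)
open import Data.Bool using (Bool; true; false)
open import Data.Fin using (Fin; punchIn)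
open import Data.Fin.Subset using (Subset; _⊆_; _⊂_; _∪_; _∩_; ∁; ⁅_⁆; ∣_∣; ⊤; _-_; _∈_)
open import Data.Fin.Permutation using (Permutation; _⟨$⟩ʳ_)
open import Data.Vec using (insertAt; tabulate; lookup)
open import Data.Product using (_×_)
open import Relation.Binary.PropositionalEquality using (_≡_; _≢_)
open import Function.Bundles using (_⇔_)

record Matroid (n : ℕ) : Set where
  field
    r        : Subset n → ℕ
    r-bound  : ∀ X → r X ≤ ∣ X ∣
    r-mono   : ∀ {X Y} → X ⊆ Y → r X ≤ r Y
    r-submod : ∀ X Y → r (X ∪ Y) + r (X ∩ Y) ≤ r X + r Y
open Matroid public

_≈M_ : ∀ {n} → Matroid n → Matroid n → Set
M ≈M N = ∀ X → r M X ≡ r N X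

-- Ground sets Fin n ⊂ Fin (suc n): the element i : Fin (suc n) is the
-- extra element, and the old element a : Fin n is identified with
-- punchIn i a.  embed i X b is the image of X, containing i iff b.

embed : ∀ {n} → Fin (suc n) → Subset n → Bool → Subset (suc n)
embed i X b = insertAt X i b

IsDeletion : ∀ {n} → Matroid (suc n) → Fin (suc n) → Matroid n → Set
IsDeletion M' i M = ∀ X → r M X ≡ r M' (embed i X false)

IsContraction : ∀ {n} → Matroid (suc n) → Fin (suc n) → Matroid n → Set
IsContraction M' i M = ∀ X → r M X ≡ r M' (embed i X true) ∸ r M' ⁅ i ⁆

IsRelabelling : ∀ {m k} → Matroid m → Permutation m k → Matroid k → Set
IsRelabelling M σ M' = ∀ Y → r M' Y ≡ r M (tabulate (λ a → lookup Y (σ ⟨$⟩ʳ a)))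

IsColoop : ∀ {n} → Matroid n → Fin n → Set
IsColoop M e = r M (⊤ - e) < r M ⊤

Spans : ∀ {n} → Matroid n → Subset n → Fin n → Set
Spans M X x = r M (X ∪ ⁅ x ⁆) ≡ r M X

SpansSet : ∀ {n} → Matroid n → Subset n → Subset n → Set
SpansSet M X F = r M (X ∪ F) ≡ r M X

IsFlat : ∀ {n} → Matroid n → Subset n → Set
IsFlat M F = ∀ y → Spans M F y → y ∈ F

IsColoopExtension : ∀ {n} → Matroid n → Fin (suc n) → Matroid (suc n) → Set
IsColoopExtension M i M' = IsDeletion M' i M × IsColoop M' i

IsPrincipalExtension : ∀ {n} → Matroid n → Subset n → Fin (suc n) → Matroid (suc n) → Set
IsPrincipalExtension M F x M' =
  IsFlat M F × IsDeletion M' x M ×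
  (∀ X → Spans M' (embed x X false) x ⇔ SpansSet M X F)

dualRank : ∀ {n} → Matroid n → Subset n → ℕ
dualRank M X = ∣ X ∣ + r M (∁ X) ∸ r M ⊤

IsCircuit : ∀ {n} → (Subset n → ℕ) → Subset n → Set
IsCircuit ρ C = ρ C < ∣ C ∣ × (∀ Y → Y ⊂ C → ρ Y ≡ ∣ Y ∣)

IsSeriesPair : ∀ {n} → Matroid n → Fin n → Fin n → Set
IsSeriesPair M e f = e ≢ f × IsCircuit (dualRank M) (⁅ e ⁆ ∪ ⁅ f ⁆)

IsSeriesExtension : ∀ {n} → Matroid n → Fin n → Fin (suc n) → Matroid (suc n) → Set
IsSeriesExtension M e e' M' = IsContraction M' e' M × IsSeriesPair M' (punchIn e' e) e'

data Constructed {n : ℕ} (N : Matroid n) : {m : ℕ} → Matroid m → Set where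
  start     : Constructed N N
  relabel   : ∀ {m k} {M : Matroid m} (σ : Permutation m k) (M' : Matroid k) →
              Constructed N M → IsRelabelling M σ M' → Constructed N M'
  delete    : ∀ {m} {M : Matroid (suc m)} (i : Fin (suc m)) (M' : Matroid m) →
              Constructed N M → IsDeletion M i M' → Constructed N M'
  contract  : ∀ {m} {M : Matroid (suc m)} (i : Fin (suc m)) (M' : Matroid m) →
              Constructed N M → IsContraction M i M' → Constructed N M'
  addColoop : ∀ {m} {M : Matroid m} (i : Fin (suc m)) (M' : Matroid (suc m)) →
              Constructed N M → IsColoopExtension M i M' → Constructed N M'
  principal : ∀ {m} {M : Matroid m} (F : Subset m) (x : Fin (suc m)) (M' : Matroid (suc m)) →
              Constructed N M → IsPrincipalExtension M F x M' → Constructed N M'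

{-# OPTIONS --safe #-}

-- M' arises from M in three steps: add e' as a coloop (giving N), add a new element freely on the
-- closure F of {e, e'} in N (a principal extension), and delete e, so that the new element takes
-- over the role of e.  Since {e, e'} is a cocircuit
-- of M', adding e or e' to a set avoiding both raises its rank; together with M' / e' = M this
-- shows that M' and N have the same rank on every set that contains e' or avoids e.  For Y ∋ e,
-- with Y₀ = Y - e, we have r(Y) ≤ r(Y₀) + 1 and r(Y) ≤ r(Y ∪ e') = r_N(Y₀ ∪ F), with equality in
-- the first when e' ∉ Y and in the second when e' ∈ Y; so r(Y) = min(r_N(Y₀) + 1, r_N(Y₀ ∪ F)),
-- which is the rank of Y₀ plus the new element in the principal extension.

module Submission where

open import Defs
open import Data.Bool using (Bool; true; false; _∨_; _∧_)
open import Data.Bool.Properties using (∨-identityʳ)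
open import Data.Fin using (Fin; zero; suc; punchIn; inject₁; _≟_)
open import Data.Fin.Subset using (Subset; _⊆_; _⊂_; _∪_; _∩_; ∁; ⁅_⁆; ∣_∣; ⊤; ⊥; _-_; _∈_; _∉_)
open import Data.Fin.Subset.Properties
  using (_∈?_; p⊆p∪q; q⊆p∪q; x∈p∪q⁻; p∩q⊆p; p∩q⊆q; x∈p∩q⁺; x∈p∩q⁻; ⊆-refl; ⊆-trans; ⊆-antisym; ⊆-min; ⊆-max;
         x∈⁅x⁆; x∈⁅y⁆⇒x≡y; ∣⁅x⁆∣≡1; ∪-identityˡ; ∪-identityʳ; ∪-comm; x∉p⇒x∈∁p; x∈∁p⇒x∉p)
open import Data.List using (List; []; _∷_; allFin)
open import Data.List.Membership.Propositional using () renaming (_∈_ to _∈ₗ_)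
open import Data.List.Membership.Propositional.Properties using (∈-allFin)
open import Data.List.Relation.Unary.Any using (here; there)
import Data.Nat as Nat
open import Data.Nat using (ℕ; suc; _+_; _∸_; _≤_; _<_; _⊓_; z≤n; s≤s; s≤s⁻¹; _≤?_)
open import Data.Nat.Properties hiding (_≟_)
open import Data.Product using (_,_; proj₁; proj₂)
open import Data.Sum using ([_,_]′)
open import Data.Vec using (Vec; _∷_; there; lookup; insertAt; removeAt; zipWith; tabulate; _[_]≔_)
open import Data.Vec.Properties
  using (lookup-zipWith; lookup-replicate; lookup∘tabulate; lookup∘updateAt; lookup∘updateAt′;
         []=⇒lookup; lookup⇒[]=; insertAt-lookup; removeAt-insertAt; insertAt-removeAt; []≔-lookup)
open import Algebra.Properties.CommutativeSemigroup +-commutativeSemigroup using (interchange)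
open import Function using (_∘_)
open import Function.Bundles using (_⇔_; mk⇔)
open import Relation.Binary.PropositionalEquality
open import Relation.Nullary using (Dec; yes; no; does; proof; contradiction)
open import Relation.Nullary.Reflects using (Reflects; invert)
open import Relation.Nullary.Decidable using (dec-true)

private
  variable
    A B D : Set
    m n : ℕ
    p q s t : Subset n

∪-lub : p ⊆ s → q ⊆ s → p ∪ q ⊆ s
∪-lub {p = p} {q = q} p⊆s q⊆s x∈p∪q = [ p⊆s , q⊆s ]′ (x∈p∪q⁻ p q x∈p∪q)

∪-mono : p ⊆ s → q ⊆ t → p ∪ q ⊆ s ∪ t
∪-mono {s = s} {t = t} p⊆s q⊆t = ∪-lub (⊆-trans p⊆s (p⊆p∪q t)) (⊆-trans q⊆t (q⊆p∪q s t))

∩-glb : s ⊆ p → s ⊆ q → s ⊆ p ∩ q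
∩-glb s⊆p s⊆q x∈s = x∈p∩q⁺ (s⊆p x∈s , s⊆q x∈s)

∩-mono : p ⊆ s → q ⊆ t → p ∩ q ⊆ s ∩ t
∩-mono {p = p} {q = q} p⊆s q⊆t = ∩-glb (⊆-trans (p∩q⊆p p q) p⊆s) (⊆-trans (p∩q⊆q p q) q⊆t)

⁅x⁆⊆p : ∀ {x : Fin n} → x ∈ p → ⁅ x ⁆ ⊆ p
⁅x⁆⊆p {p = p} {x} x∈p y∈⁅x⁆ = subst (_∈ p) (sym (x∈⁅y⁆⇒x≡y x y∈⁅x⁆)) x∈p

⊆-∁[⁅x⁆∪⁅y⁆] : ∀ {x y : Fin n} → x ∉ p → y ∉ p → p ⊆ ∁ (⁅ x ⁆ ∪ ⁅ y ⁆)
⊆-∁[⁅x⁆∪⁅y⁆] {p = p} {x} {y} x∉p y∉p {k} k∈p = x∉p⇒x∈∁p ([ x∉p ∘ at x , y∉p ∘ at y ]′ ∘ x∈p∪q⁻ _ _)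
  where
  at : ∀ z → k ∈ ⁅ z ⁆ → z ∈ p
  at z k∈⁅z⁆ = subst (_∈ p) (x∈⁅y⁆⇒x≡y z k∈⁅z⁆) k∈p

∉⇒lookup≡false : ∀ {x : Fin n} → x ∉ p → lookup p x ≡ false
∉⇒lookup≡false {p = p} {x} x∉p with lookup p x in eq
... | true  = contradiction (lookup⇒[]= x p eq) x∉p
... | false = refl

lookup≡false⇒∉ : ∀ {x : Fin n} → lookup p x ≡ false → x ∉ p
lookup≡false⇒∉ x∉p x∈p with () ← trans (sym ([]=⇒lookup x∈p)) x∉p

lookup-mono : p ⊆ q → ∀ x → lookup p x ≡ true → lookup q x ≡ true
lookup-mono {p = p} p⊆q x x∈p = []=⇒lookup (p⊆q (lookup⇒[]= x p x∈p))

does-true⇒ : (d : Dec A) → does d ≡ true → A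
does-true⇒ d eq = invert (subst (Reflects _) eq (proof d))

lookup-removeAt : ∀ (xs : Vec A (suc n)) i k → lookup (removeAt xs i) k ≡ lookup xs (punchIn i k)
lookup-removeAt (x ∷ xs)     zero    k       = refl
lookup-removeAt (x ∷ y ∷ xs) (suc i) zero    = refl
lookup-removeAt (x ∷ y ∷ xs) (suc i) (suc k) = lookup-removeAt (y ∷ xs) i k

removeAt-zipWith : ∀ (f : A → B → D) (xs : Vec A (suc n)) ys i →
                   removeAt (zipWith f xs ys) i ≡ zipWith f (removeAt xs i) (removeAt ys i)
removeAt-zipWith f (x ∷ xs)     (y ∷ ys)      zero    = refl
removeAt-zipWith f (x ∷ x' ∷ xs) (y ∷ y' ∷ ys) (suc i) =
  cong (f x y ∷_) (removeAt-zipWith f (x' ∷ xs) (y' ∷ ys) i)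

removeAt-mono : ∀ {p q : Subset (suc n)} i → p ⊆ q → removeAt p i ⊆ removeAt q i
removeAt-mono {p = p} {q} i p⊆q {k} k∈p = lookup⇒[]= k _ (trans (lookup-removeAt q i k)
  (lookup-mono p⊆q (punchIn i k) (trans (sym (lookup-removeAt p i k)) ([]=⇒lookup k∈p))))

insertAt-removeAt-∈ : ∀ (p : Subset (suc n)) {i} → i ∈ p → insertAt (removeAt p i) i true ≡ p
insertAt-removeAt-∈ p {i} i∈p =
  trans (cong (insertAt (removeAt p i) i) (sym ([]=⇒lookup i∈p))) (insertAt-removeAt p i)

removeAt-⁅⁆ : ∀ (i : Fin (suc n)) → removeAt ⁅ i ⁆ i ≡ ⊥
removeAt-⁅⁆ zero          = refl
removeAt-⁅⁆ (suc zero)    = refl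
removeAt-⁅⁆ (suc (suc i)) = cong (false ∷_) (removeAt-⁅⁆ (suc i))

removeAt-∪-⁅⁆ : ∀ (p : Subset (suc n)) i → removeAt (p ∪ ⁅ i ⁆) i ≡ removeAt p i
removeAt-∪-⁅⁆ p i = begin
  removeAt (p ∪ ⁅ i ⁆) i          ≡⟨ removeAt-zipWith _∨_ p ⁅ i ⁆ i ⟩
  removeAt p i ∪ removeAt ⁅ i ⁆ i ≡⟨ cong (removeAt p i ∪_) (removeAt-⁅⁆ i) ⟩
  removeAt p i ∪ ⊥                ≡⟨ ∪-identityʳ _ ⟩
  removeAt p i                    ∎
  where open ≡-Reasoning

lookup-insertAt-suc-inject₁ : ∀ (xs : Vec A (suc n)) i v →
                              lookup (insertAt xs (suc i) v) (inject₁ i) ≡ lookup xs i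
lookup-insertAt-suc-inject₁ (x ∷ xs)     zero    v = refl
lookup-insertAt-suc-inject₁ (x ∷ y ∷ xs) (suc i) v = lookup-insertAt-suc-inject₁ (y ∷ xs) i v

removeAt-inject₁-insertAt-suc : ∀ (xs : Vec A (suc n)) i v →
                                removeAt (insertAt xs (suc i) v) (inject₁ i) ≡ xs [ i ]≔ v
removeAt-inject₁-insertAt-suc (x ∷ xs)     zero    v = refl
removeAt-inject₁-insertAt-suc (x ∷ y ∷ xs) (suc i) v = cong (x ∷_) (removeAt-inject₁-insertAt-suc (y ∷ xs) i v)

insertAt-false-∪-⁅⁆ : ∀ (p : Subset n) i → insertAt p i false ∪ ⁅ i ⁆ ≡ insertAt p i true
insertAt-false-∪-⁅⁆ p        zero    = cong (true ∷_) (∪-identityʳ p)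
insertAt-false-∪-⁅⁆ (x ∷ p) (suc i) = cong₂ _∷_ (∨-identityʳ x) (insertAt-false-∪-⁅⁆ p i)

toℕ : Bool → ℕ
toℕ false = 0
toℕ true  = 1

∣insertAt∣ : ∀ (p : Subset n) i b → ∣ insertAt p i b ∣ ≡ ∣ p ∣ + toℕ b
∣insertAt∣ p         zero    false = sym (+-identityʳ ∣ p ∣)
∣insertAt∣ p         zero    true  = +-comm 1 ∣ p ∣
∣insertAt∣ (true ∷ p)  (suc i) b   = cong suc (∣insertAt∣ p i b)
∣insertAt∣ (false ∷ p) (suc i) b   = ∣insertAt∣ p i b

∣p∣≡∣removeAt∣+toℕ-lookup : ∀ (p : Subset (suc n)) i → ∣ p ∣ ≡ ∣ removeAt p i ∣ + toℕ (lookup p i)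
∣p∣≡∣removeAt∣+toℕ-lookup p i =
  trans (cong ∣_∣ (sym (insertAt-removeAt p i))) (∣insertAt∣ (removeAt p i) i (lookup p i))

toℕ-mono : ∀ {a b} → (a ≡ true → b ≡ true) → toℕ a ≤ toℕ b
toℕ-mono {false} _    = z≤n
toℕ-mono {true}  a⇒b rewrite a⇒b refl = ≤-refl

toℕ-∨-∧ : ∀ a b → toℕ (a ∨ b) + toℕ (a ∧ b) ≡ toℕ a + toℕ b
toℕ-∨-∧ false false = refl
toℕ-∨-∧ false true  = refl
toℕ-∨-∧ true  false = refl
toℕ-∨-∧ true  true  = refl

x∉p-x : ∀ (p : Subset n) x → x ∉ p - x
x∉p-x (_ ∷ p) zero    ()
x∉p-x (_ ∷ p) (suc x) (there x∈p-x) = x∉p-x p x x∈p-x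

∉-[]≔false : ∀ (p : Subset n) j → j ∉ p [ j ]≔ false
∉-[]≔false p j j∈ with () ← trans (sym (lookup∘updateAt j p)) ([]=⇒lookup j∈)

[]≔false-⊆ : ∀ (p : Subset n) j → p [ j ]≔ false ⊆ p
[]≔false-⊆ p j {k} k∈ with k ≟ j
... | yes refl = contradiction k∈ (∉-[]≔false p j)
... | no  k≢j  = lookup⇒[]= k p (trans (sym (lookup∘updateAt′ k j k≢j p)) ([]=⇒lookup k∈))

⊆-[]≔false-∪ : ∀ (p : Subset n) j → p ⊆ (p [ j ]≔ false) ∪ ⁅ j ⁆
⊆-[]≔false-∪ p j {k} k∈ with k ≟ j
... | yes refl = q⊆p∪q _ _ (x∈⁅x⁆ j)
... | no  k≢j  = p⊆p∪q _ (lookup⇒[]= k _ (trans (lookup∘updateAt′ k j k≢j p) ([]=⇒lookup k∈)))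

⁅x⁆⊂⁅x⁆∪⁅y⁆ : ∀ {x y : Fin n} → x ≢ y → ⁅ x ⁆ ⊂ ⁅ x ⁆ ∪ ⁅ y ⁆
⁅x⁆⊂⁅x⁆∪⁅y⁆ {x = x} {y} x≢y = p⊆p∪q _ , y , q⊆p∪q _ _ (x∈⁅x⁆ y) , x≢y ∘ sym ∘ x∈⁅y⁆⇒x≡y x

⁅y⁆⊂⁅x⁆∪⁅y⁆ : ∀ {x y : Fin n} → x ≢ y → ⁅ y ⁆ ⊂ ⁅ x ⁆ ∪ ⁅ y ⁆
⁅y⁆⊂⁅x⁆∪⁅y⁆ {x = x} {y} x≢y = q⊆p∪q _ _ , x , p⊆p∪q _ (x∈⁅x⁆ x) , x≢y ∘ x∈⁅y⁆⇒x≡y y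

∁⁅y⁆⊆∁[⁅x⁆∪⁅y⁆]∪⁅x⁆ : ∀ (x y : Fin n) → ∁ ⁅ y ⁆ ⊆ ∁ (⁅ x ⁆ ∪ ⁅ y ⁆) ∪ ⁅ x ⁆
∁⁅y⁆⊆∁[⁅x⁆∪⁅y⁆]∪⁅x⁆ x y {k} k∈∁⁅y⁆ with k ≟ x
... | yes refl = q⊆p∪q _ _ (x∈⁅x⁆ x)
... | no  k≢x  = p⊆p∪q _ (x∉p⇒x∈∁p ([ k≢x ∘ x∈⁅y⁆⇒x≡y x , x∈∁p⇒x∉p k∈∁⁅y⁆ ]′ ∘ x∈p∪q⁻ _ _))

∁⁅x⁆⊆∁[⁅x⁆∪⁅y⁆]∪⁅y⁆ : ∀ (x y : Fin n) → ∁ ⁅ x ⁆ ⊆ ∁ (⁅ x ⁆ ∪ ⁅ y ⁆) ∪ ⁅ y ⁆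
∁⁅x⁆⊆∁[⁅x⁆∪⁅y⁆]∪⁅y⁆ x y = subst (λ p → ∁ ⁅ x ⁆ ⊆ ∁ p ∪ ⁅ y ⁆) (∪-comm ⁅ y ⁆ ⁅ x ⁆) (∁⁅y⁆⊆∁[⁅x⁆∪⁅y⁆]∪⁅x⁆ y x)

m+n∸o<m⇒n<o : ∀ m n o → m + n ∸ o < m → n < o
m+n∸o<m⇒n<o m n o m+n∸o<m with o ≤? n
... | no  o≰n = ≰⇒> o≰n
... | yes o≤n = contradiction (≤-trans (m≤m+n m (n ∸ o)) (≤-reflexive (sym (+-∸-assoc m o≤n)))) (<⇒≱ m+n∸o<m)

suc[n]∸o≡1⇒o≤n : ∀ n o → suc n ∸ o ≡ 1 → o ≤ n
suc[n]∸o≡1⇒o≤n n o eq with o ≤? n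
... | yes o≤n = o≤n
... | no  o≰n = contradiction (trans (sym (m≤n⇒m∸n≡0 (≰⇒> o≰n))) eq) 0≢1+n

x≤a⊓b+c : ∀ {x} a b c → x ≤ a + c → x ≤ b + c → x ≤ a ⊓ b + c
x≤a⊓b+c a b c x≤a+c x≤b+c = subst (_ ≤_) (sym (+-distribʳ-⊓ c a b)) (⊓-glb x≤a+c x≤b+c)

x≤c+a⊓b : ∀ {x} a b c → x ≤ c + a → x ≤ c + b → x ≤ c + a ⊓ b
x≤c+a⊓b a b c x≤c+a x≤c+b = subst (_ ≤_) (sym (+-distribˡ-⊓ c a b)) (⊓-glb x≤c+a x≤c+b)

+-suc-mono-≤ : ∀ {a b c d} → a + b ≤ c + d → a + suc b ≤ c + suc d
+-suc-mono-≤ {a} {b} {c} {d} = subst₂ _≤_ (sym (+-suc a b)) (sym (+-suc c d)) ∘ s≤s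

suc[m]⊓n≡m⇔n≡m : ∀ {m n} → m ≤ n → (suc m ⊓ n ≡ m ⇔ n ≡ m)
suc[m]⊓n≡m⇔n≡m {m} {n} m≤n = mk⇔ to (λ n≡m → trans (cong (suc m ⊓_) n≡m) (m≥n⇒m⊓n≡n (n≤1+n m)))
  where
  to : suc m ⊓ n ≡ m → n ≡ m
  to eq with suc m ≤? n
  ... | yes 1+m≤n = contradiction (trans (sym (m≤n⇒m⊓n≡m 1+m≤n)) eq) 1+n≢n
  ... | no  1+m≰n = ≤-antisym (s≤s⁻¹ (≰⇒> 1+m≰n)) m≤n

module _ (N : Matroid n) where

  r-submod-⊆ : ∀ {U I X Y} → U ⊆ X ∪ Y → I ⊆ X ∩ Y → r N U + r N I ≤ r N X + r N Y
  r-submod-⊆ {X = X} {Y} U⊆ I⊆ = ≤-trans (+-mono-≤ (r-mono N U⊆) (r-mono N I⊆)) (r-submod N X Y)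

  r-⁅⁆≤1 : ∀ x → r N ⁅ x ⁆ ≤ 1
  r-⁅⁆≤1 x = ≤-trans (r-bound N ⁅ x ⁆) (≤-reflexive (∣⁅x⁆∣≡1 x))

  r-≤-suc : ∀ {X Y x} → Y ⊆ X ∪ ⁅ x ⁆ → r N Y ≤ suc (r N X)
  r-≤-suc {X} {Y} {x} Y⊆ = begin
    r N Y                    ≤⟨ m≤m+n (r N Y) (r N ⊥) ⟩
    r N Y + r N ⊥            ≤⟨ r-submod-⊆ Y⊆ (⊆-min _) ⟩
    r N X + r N ⁅ x ⁆        ≤⟨ +-monoʳ-≤ (r N X) (r-⁅⁆≤1 x) ⟩
    r N X + 1                ≡⟨ +-comm (r N X) 1 ⟩
    suc (r N X)              ∎
    where open ≤-Reasoning

  -- The hypotheses say that x raises the rank of H; submodularity passes this on to every Y ⊆ H.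
  r-∪⁅⁆≡suc : ∀ {H B x Y} → B ⊆ H ∪ ⁅ x ⁆ → r N H < r N B → Y ⊆ H → r N (Y ∪ ⁅ x ⁆) ≡ suc (r N Y)
  r-∪⁅⁆≡suc {H} {B} {x} {Y} B⊆ H<B Y⊆H = ≤-antisym (r-≤-suc ⊆-refl) (+-cancelˡ-≤ (r N H) _ _ (begin
    r N H + suc (r N Y)                       ≡⟨ +-suc (r N H) (r N Y) ⟩
    suc (r N H) + r N Y                       ≤⟨ +-monoˡ-≤ (r N Y) H<B ⟩
    r N B + r N Y                             ≤⟨ r-submod-⊆ B⊆H∪Y∪x Y⊆H∩Y∪x ⟩
    r N H + r N (Y ∪ ⁅ x ⁆)                   ∎))
    where
    open ≤-Reasoning
    B⊆H∪Y∪x : B ⊆ H ∪ (Y ∪ ⁅ x ⁆)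
    B⊆H∪Y∪x = ⊆-trans B⊆ (∪-mono ⊆-refl (q⊆p∪q Y ⁅ x ⁆))
    Y⊆H∩Y∪x : Y ⊆ H ∩ (Y ∪ ⁅ x ⁆)
    Y⊆H∩Y∪x = ∩-glb Y⊆H (p⊆p∪q ⁅ x ⁆)

module _ (N : Matroid n) {a b : Fin n} (series : IsSeriesPair N a b) where

  private
    a≢b = proj₁ series
    cocircuit = proj₁ (proj₂ series)
    minimal = proj₂ (proj₂ series)

    r-∁pair<r-⊤ : r N (∁ (⁅ a ⁆ ∪ ⁅ b ⁆)) < r N ⊤
    r-∁pair<r-⊤ = m+n∸o<m⇒n<o _ _ _ cocircuit

    r-⊤≤r-∁ : ∀ {x} → ⁅ x ⁆ ⊂ ⁅ a ⁆ ∪ ⁅ b ⁆ → r N ⊤ ≤ r N (∁ ⁅ x ⁆)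
    r-⊤≤r-∁ {x} x⊂pair =
      suc[n]∸o≡1⇒o≤n _ _ (subst (λ k → k + r N (∁ ⁅ x ⁆) ∸ r N ⊤ ≡ k) (∣⁅x⁆∣≡1 x) (minimal ⁅ x ⁆ x⊂pair))

  seriesPair-r-∪ˡ : ∀ {Y} → Y ⊆ ∁ (⁅ a ⁆ ∪ ⁅ b ⁆) → r N (Y ∪ ⁅ a ⁆) ≡ suc (r N Y)
  seriesPair-r-∪ˡ = r-∪⁅⁆≡suc N (∁⁅y⁆⊆∁[⁅x⁆∪⁅y⁆]∪⁅x⁆ a b) (<-≤-trans r-∁pair<r-⊤ (r-⊤≤r-∁ (⁅y⁆⊂⁅x⁆∪⁅y⁆ a≢b)))

  seriesPair-r-∪ʳ : ∀ {Y} → Y ⊆ ∁ (⁅ a ⁆ ∪ ⁅ b ⁆) → r N (Y ∪ ⁅ b ⁆) ≡ suc (r N Y)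
  seriesPair-r-∪ʳ = r-∪⁅⁆≡suc N (∁⁅x⁆⊆∁[⁅x⁆∪⁅y⁆]∪⁅y⁆ a b) (<-≤-trans r-∁pair<r-⊤ (r-⊤≤r-∁ (⁅x⁆⊂⁅x⁆∪⁅y⁆ a≢b)))

module Closure (N : Matroid n) where

  cl : Subset n → Subset n
  cl S = tabulate (λ y → does (r N (S ∪ ⁅ y ⁆) Nat.≟ r N S))

  ∈-cl⇒spans : ∀ {S y} → y ∈ cl S → Spans N S y
  ∈-cl⇒spans {S} {y} y∈cl =
    does-true⇒ (r N (S ∪ ⁅ y ⁆) Nat.≟ r N S) (trans (sym (lookup∘tabulate _ y)) ([]=⇒lookup y∈cl))

  spans⇒∈-cl : ∀ {S y} → Spans N S y → y ∈ cl S
  spans⇒∈-cl {S} {y} S-spans-y =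
    lookup⇒[]= y (cl S) (trans (lookup∘tabulate _ y) (dec-true (r N (S ∪ ⁅ y ⁆) Nat.≟ r N S) S-spans-y))

  ⊆-cl : ∀ S → S ⊆ cl S
  ⊆-cl S {y} y∈S = spans⇒∈-cl (cong (r N) (⊆-antisym (∪-lub ⊆-refl (⁅x⁆⊆p y∈S)) (p⊆p∪q ⁅ y ⁆)))

  spans-∪ : ∀ {S y} W → Spans N S y → Spans N (W ∪ S) y
  spans-∪ {S} {y} W S-spans-y = ≤-antisym (+-cancelʳ-≤ (r N S) _ _ (begin
      r N ((W ∪ S) ∪ ⁅ y ⁆) + r N S
        ≤⟨ r-submod-⊆ N (∪-mono ⊆-refl (q⊆p∪q S ⁅ y ⁆)) (∩-glb (q⊆p∪q W S) (p⊆p∪q ⁅ y ⁆)) ⟩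
      r N (W ∪ S) + r N (S ∪ ⁅ y ⁆)   ≡⟨ cong (r N (W ∪ S) +_) S-spans-y ⟩
      r N (W ∪ S) + r N S             ∎))
    (r-mono N (p⊆p∪q ⁅ y ⁆))
    where open ≤-Reasoning

  r-∪-spanned : ∀ {Z T} → (∀ {y} → y ∈ T → Spans N Z y) → r N (Z ∪ T) ≡ r N Z
  r-∪-spanned {Z} {T} Z-spans-T =
    ≤-antisym (≤-trans (r-mono N (∪-mono ⊆-refl T⊆T↾allFin)) (r-∪-T↾ (allFin n))) (r-mono N (p⊆p∪q T))
    where
    open ≤-Reasoning
    T↾ : List (Fin n) → Subset n
    T↾ []       = ⊥
    T↾ (y ∷ ys) = (⁅ y ⁆ ∩ T) ∪ T↾ ys

    ∈-T↾ : ∀ {y} ys → y ∈ₗ ys → y ∈ T → y ∈ T↾ ys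
    ∈-T↾ (y ∷ ys) (here refl)  y∈T = p⊆p∪q _ (x∈p∩q⁺ (x∈⁅x⁆ y , y∈T))
    ∈-T↾ (x ∷ ys) (there y∈ys) y∈T = q⊆p∪q _ _ (∈-T↾ ys y∈ys y∈T)

    T⊆T↾allFin : T ⊆ T↾ (allFin n)
    T⊆T↾allFin y∈T = ∈-T↾ (allFin n) (∈-allFin _) y∈T

    r-∪-⁅y⁆∩T : ∀ y → r N (Z ∪ (⁅ y ⁆ ∩ T)) ≤ r N Z
    r-∪-⁅y⁆∩T y with y ∈? T
    ... | yes y∈T = ≤-trans (r-mono N (∪-mono ⊆-refl (p∩q⊆p ⁅ y ⁆ T))) (≤-reflexive (Z-spans-T y∈T))
    ... | no  y∉T = r-mono N (∪-lub ⊆-refl ⁅y⁆∩T⊆Z)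
      where
      ⁅y⁆∩T⊆Z : ⁅ y ⁆ ∩ T ⊆ Z
      ⁅y⁆∩T⊆Z x∈ with x∈⁅y⁆ , x∈T ← x∈p∩q⁻ ⁅ y ⁆ T x∈ =
        contradiction (subst (_∈ T) (x∈⁅y⁆⇒x≡y y x∈⁅y⁆) x∈T) y∉T

    r-∪-T↾ : ∀ ys → r N (Z ∪ T↾ ys) ≤ r N Z
    r-∪-T↾ []       = ≤-reflexive (cong (r N) (∪-identityʳ Z))
    r-∪-T↾ (y ∷ ys) = +-cancelʳ-≤ (r N Z) _ _ (begin
      r N (Z ∪ T↾ (y ∷ ys)) + r N Z             ≤⟨ r-submod-⊆ N U⊆ (∩-glb (p⊆p∪q _) (p⊆p∪q _)) ⟩
      r N (Z ∪ (⁅ y ⁆ ∩ T)) + r N (Z ∪ T↾ ys)   ≤⟨ +-mono-≤ (r-∪-⁅y⁆∩T y) (r-∪-T↾ ys) ⟩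
      r N Z + r N Z                             ∎)
      where
      U⊆ : Z ∪ T↾ (y ∷ ys) ⊆ (Z ∪ (⁅ y ⁆ ∩ T)) ∪ (Z ∪ T↾ ys)
      U⊆ = ∪-lub (⊆-trans (p⊆p∪q _) (p⊆p∪q _)) (∪-mono (q⊆p∪q Z _) (q⊆p∪q Z _))

  r-∪-cl : ∀ S W → r N (W ∪ cl S) ≡ r N (W ∪ S)
  r-∪-cl S W = ≤-antisym
    (≤-trans (r-mono N (∪-mono (p⊆p∪q S) ⊆-refl)) (≤-reflexive (r-∪-spanned (spans-∪ W ∘ ∈-cl⇒spans))))
    (r-mono N (∪-mono ⊆-refl (⊆-cl S)))

  cl-isFlat : ∀ S → IsFlat N (cl S)
  cl-isFlat S y cl-spans-y = spans⇒∈-cl (≤-antisym (begin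
      r N (S ∪ ⁅ y ⁆)        ≤⟨ r-mono N (∪-mono (⊆-cl S) ⊆-refl) ⟩
      r N (cl S ∪ ⁅ y ⁆)     ≡⟨ cl-spans-y ⟩
      r N (cl S)             ≡⟨ cong (r N) (⊆-antisym (q⊆p∪q S (cl S)) (∪-lub (⊆-cl S) ⊆-refl)) ⟩
      r N (S ∪ cl S)         ≡⟨ r-∪-spanned ∈-cl⇒spans ⟩
      r N S                  ∎)
    (r-mono N (p⊆p∪q ⁅ y ⁆)))
    where open ≤-Reasoning

withColoop : Matroid n → Fin (suc n) → Matroid (suc n)
withColoop M i = record { r = ρ ; r-bound = ρ-bound ; r-mono = ρ-mono ; r-submod = ρ-submod }
  where
  ρ : Subset _ → ℕ
  ρ Y = r M (removeAt Y i) + toℕ (lookup Y i)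

  ρ-bound : ∀ Y → ρ Y ≤ ∣ Y ∣
  ρ-bound Y = ≤-trans (+-monoˡ-≤ _ (r-bound M (removeAt Y i))) (≤-reflexive (sym (∣p∣≡∣removeAt∣+toℕ-lookup Y i)))

  ρ-mono : ∀ {X Y} → X ⊆ Y → ρ X ≤ ρ Y
  ρ-mono X⊆Y = +-mono-≤ (r-mono M (removeAt-mono i X⊆Y)) (toℕ-mono (lookup-mono X⊆Y i))

  ρ-submod : ∀ X Y → ρ (X ∪ Y) + ρ (X ∩ Y) ≤ ρ X + ρ Y
  ρ-submod X Y
    rewrite removeAt-zipWith _∨_ X Y i | removeAt-zipWith _∧_ X Y i
          | lookup-zipWith _∨_ i X Y | lookup-zipWith _∧_ i X Y = begin
    (r M (X' ∪ Y') + toℕ (x ∨ y)) + (r M (X' ∩ Y') + toℕ (x ∧ y))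
      ≡⟨ interchange (r M (X' ∪ Y')) (toℕ (x ∨ y)) (r M (X' ∩ Y')) (toℕ (x ∧ y)) ⟩
    (r M (X' ∪ Y') + r M (X' ∩ Y')) + (toℕ (x ∨ y) + toℕ (x ∧ y))
      ≤⟨ +-mono-≤ (r-submod M X' Y') (≤-reflexive (toℕ-∨-∧ x y)) ⟩
    (r M X' + r M Y') + (toℕ x + toℕ y)
      ≡⟨ interchange (r M X') (r M Y') (toℕ x) (toℕ y) ⟩
    (r M X' + toℕ x) + (r M Y' + toℕ y)
      ∎
    where
    open ≤-Reasoning
    X' = removeAt X i
    Y' = removeAt Y i
    x = lookup X i
    y = lookup Y i

withColoop-isColoopExtension : ∀ (M : Matroid n) i → IsColoopExtension M i (withColoop M i)
withColoop-isColoopExtension M i = deletion , coloop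
  where
  deletion : IsDeletion (withColoop M i) i M
  deletion X rewrite removeAt-insertAt X i false | insertAt-lookup X i false = sym (+-identityʳ (r M X))

  coloop : IsColoop (withColoop M i) i
  coloop rewrite ∉⇒lookup≡false (x∉p-x ⊤ i) | lookup-replicate {n = suc _} i true = begin-strict
    r M (removeAt (⊤ - i) i) + 0   ≤⟨ +-monoˡ-≤ 0 (r-mono M (removeAt-mono i (⊆-max (⊤ - i)))) ⟩
    r M (removeAt ⊤ i) + 0         <⟨ +-monoʳ-< (r M (removeAt ⊤ i)) (s≤s z≤n) ⟩
    r M (removeAt ⊤ i) + 1         ∎
    where open ≤-Reasoning

r-withColoop-∈ : ∀ (M : Matroid n) {i Y} → i ∈ Y → r (withColoop M i) Y ≡ suc (r M (removeAt Y i))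
r-withColoop-∈ M {i} {Y} i∈Y rewrite []=⇒lookup i∈Y = +-comm (r M (removeAt Y i)) 1

r-withColoop-∉ : ∀ (M : Matroid n) {i Y} → i ∉ Y → r (withColoop M i) Y ≡ r M (removeAt Y i)
r-withColoop-∉ M {i} {Y} i∉Y rewrite ∉⇒lookup≡false i∉Y = +-identityʳ (r M (removeAt Y i))

module _ (P : Matroid m) (F : Subset m) where

  -- principalRank b X is the rank of X together with the new element when b holds.
  principalRank : Bool → Subset m → ℕ
  principalRank false X = r P X
  principalRank true  X = suc (r P X) ⊓ r P (X ∪ F)

  principalRank-bound : ∀ b X → principalRank b X ≤ ∣ X ∣ + toℕ b
  principalRank-bound false X = ≤-trans (r-bound P X) (m≤m+n ∣ X ∣ 0)
  principalRank-bound true  X = ≤-trans (m⊓n≤m _ _) (≤-trans (s≤s (r-bound P X)) (≤-reflexive (+-comm 1 ∣ X ∣)))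

  principalRank-mono : ∀ {a b X Y} → (a ≡ true → b ≡ true) → X ⊆ Y → principalRank a X ≤ principalRank b Y
  principalRank-mono {false} {false} _ X⊆Y = r-mono P X⊆Y
  principalRank-mono {false} {true}  _ X⊆Y =
    ⊓-glb (≤-trans (r-mono P X⊆Y) (n≤1+n _)) (r-mono P (⊆-trans X⊆Y (p⊆p∪q F)))
  principalRank-mono {true}  {false} a⇒b _ with () ← a⇒b refl
  principalRank-mono {true}  {true}  _ X⊆Y = ⊓-mono-≤ (s≤s (r-mono P X⊆Y)) (r-mono P (∪-mono X⊆Y ⊆-refl))

  private
    module Submodularity (X Y : Subset m) where
      u  = r P (X ∪ Y)
      uF = r P ((X ∪ Y) ∪ F)
      i  = r P (X ∩ Y)
      iF = r P ((X ∩ Y) ∪ F)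
      x  = r P X
      xF = r P (X ∪ F)
      y  = r P Y
      yF = r P (Y ∪ F)

      submod : u + i ≤ x + y
      submod = r-submod P X Y

      submod-F∪ : uF + i ≤ xF + y
      submod-F∪ = r-submod-⊆ P (∪-lub (∪-mono (p⊆p∪q F) ⊆-refl) (⊆-trans (q⊆p∪q X F) (p⊆p∪q Y)))
                               (∩-mono (p⊆p∪q F) ⊆-refl)

      submod-∪F : uF + i ≤ x + yF
      submod-∪F = r-submod-⊆ P (∪-lub (∪-mono ⊆-refl (p⊆p∪q F)) (⊆-trans (q⊆p∪q Y F) (q⊆p∪q X _)))
                               (∩-mono ⊆-refl (p⊆p∪q F))

      submod-F∪F : uF + iF ≤ xF + yF
      submod-F∪F = r-submod-⊆ P (∪-lub (∪-mono (p⊆p∪q F) (p⊆p∪q F)) (⊆-trans (q⊆p∪q X F) (p⊆p∪q _)))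
                                (∪-lub (∩-mono (p⊆p∪q F) (p⊆p∪q F)) (∩-glb (q⊆p∪q X F) (q⊆p∪q Y F)))

  principalRank-submod : ∀ a b X Y →
    principalRank (a ∨ b) (X ∪ Y) + principalRank (a ∧ b) (X ∩ Y) ≤ principalRank a X + principalRank b Y
  principalRank-submod false false X Y = r-submod P X Y
  principalRank-submod true  false X Y = x≤a⊓b+c (suc x) xF y
    (≤-trans (+-monoˡ-≤ i (m⊓n≤m (suc u) uF)) (s≤s submod))
    (≤-trans (+-monoˡ-≤ i (m⊓n≤n (suc u) uF)) submod-F∪)
    where open Submodularity X Y
  principalRank-submod false true  X Y = x≤c+a⊓b (suc y) yF x
    (≤-trans (+-monoˡ-≤ i (m⊓n≤m (suc u) uF)) (subst (suc (u + i) ≤_) (sym (+-suc x y)) (s≤s submod)))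
    (≤-trans (+-monoˡ-≤ i (m⊓n≤n (suc u) uF)) submod-∪F)
    where open Submodularity X Y
  principalRank-submod true  true  X Y = x≤a⊓b+c (suc x) xF (suc y ⊓ yF)
    (x≤c+a⊓b (suc y) yF (suc x)
      (≤-trans (+-mono-≤ (m⊓n≤m (suc u) uF) (m⊓n≤m (suc i) iF)) (s≤s (+-suc-mono-≤ submod)))
      (≤-trans (+-mono-≤ (m⊓n≤n (suc u) uF) (m⊓n≤m (suc i) iF))
               (subst (_≤ suc (x + yF)) (sym (+-suc uF i)) (s≤s submod-∪F))))
    (x≤c+a⊓b (suc y) yF xF
      (≤-trans (+-mono-≤ (m⊓n≤n (suc u) uF) (m⊓n≤m (suc i) iF)) (+-suc-mono-≤ submod-F∪))
      (≤-trans (+-mono-≤ (m⊓n≤n (suc u) uF) (m⊓n≤n (suc i) iF)) submod-F∪F))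
    where open Submodularity X Y

principalExtension : Matroid m → Subset m → Fin (suc m) → Matroid (suc m)
principalExtension P F p = record { r = ρ ; r-bound = ρ-bound ; r-mono = ρ-mono ; r-submod = ρ-submod }
  where
  ρ : Subset _ → ℕ
  ρ Y = principalRank P F (lookup Y p) (removeAt Y p)

  ρ-bound : ∀ Y → ρ Y ≤ ∣ Y ∣
  ρ-bound Y = ≤-trans (principalRank-bound P F (lookup Y p) (removeAt Y p))
                      (≤-reflexive (sym (∣p∣≡∣removeAt∣+toℕ-lookup Y p)))

  ρ-mono : ∀ {X Y} → X ⊆ Y → ρ X ≤ ρ Y
  ρ-mono X⊆Y = principalRank-mono P F (lookup-mono X⊆Y p) (removeAt-mono p X⊆Y)

  ρ-submod : ∀ X Y → ρ (X ∪ Y) + ρ (X ∩ Y) ≤ ρ X + ρ Y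
  ρ-submod X Y
    rewrite removeAt-zipWith _∨_ X Y p | removeAt-zipWith _∧_ X Y p
          | lookup-zipWith _∨_ p X Y | lookup-zipWith _∧_ p X Y =
    principalRank-submod P F (lookup X p) (lookup Y p) (removeAt X p) (removeAt Y p)

principalExtension-isPrincipalExtension : ∀ (P : Matroid m) F p → IsFlat P F →
                                          IsPrincipalExtension P F p (principalExtension P F p)
principalExtension-isPrincipalExtension P F p F-flat = F-flat , deletion , spans
  where
  deletion : IsDeletion (principalExtension P F p) p P
  deletion X rewrite insertAt-lookup X p false | removeAt-insertAt X p false = refl

  spans : ∀ X → Spans (principalExtension P F p) (embed p X false) p ⇔ SpansSet P X F
  spans X rewrite insertAt-false-∪-⁅⁆ X p
                | insertAt-lookup X p true  | removeAt-insertAt X p true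
                | insertAt-lookup X p false | removeAt-insertAt X p false =
    suc[m]⊓n≡m⇔n≡m (r-mono P (p⊆p∪q F))

module SeriesExtension (M : Matroid n) (e : Fin n) (e' : Fin (suc n)) (M' : Matroid (suc n))
                       (M'/e'≈M : IsContraction M' e' M) (series : IsSeriesPair M' (punchIn e' e) e') where

  ê : Fin (suc n)
  ê = punchIn e' e

  N : Matroid (suc n)
  N = withColoop M e'

  F : Subset (suc n)
  F = Closure.cl N (⁅ ê ⁆ ∪ ⁅ e' ⁆)

  r-⁅e'⁆ : r M' ⁅ e' ⁆ ≡ 1
  r-⁅e'⁆ = ≤-antisym (r-⁅⁆≤1 M' e') (begin
    1                     ≤⟨ s≤s z≤n ⟩
    suc (r M' ⊥)          ≡⟨ seriesPair-r-∪ʳ M' series (⊆-min _) ⟨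
    r M' (⊥ ∪ ⁅ e' ⁆)     ≡⟨ cong (r M') (∪-identityˡ ⁅ e' ⁆) ⟩
    r M' ⁅ e' ⁆           ∎)
    where open ≤-Reasoning

  r-M'-∋e' : ∀ {Y} → e' ∈ Y → r M' Y ≡ suc (r M (removeAt Y e'))
  r-M'-∋e' {Y} e'∈Y = begin
    r M' Y                     ≡⟨ m∸n+n≡m 1≤r-Y ⟨
    r M' Y ∸ 1 + 1             ≡⟨ +-comm _ 1 ⟩
    suc (r M' Y ∸ 1)           ≡⟨ cong suc r-M'/e' ⟨
    suc (r M (removeAt Y e'))  ∎
    where
    open ≡-Reasoning
    1≤r-Y : 1 ≤ r M' Y
    1≤r-Y = ≤-trans (≤-reflexive (sym r-⁅e'⁆)) (r-mono M' (⁅x⁆⊆p e'∈Y))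
    r-M'/e' : r M (removeAt Y e') ≡ r M' Y ∸ 1
    r-M'/e' = trans (M'/e'≈M (removeAt Y e')) (cong₂ _∸_ (cong (r M') (insertAt-removeAt-∈ Y e'∈Y)) r-⁅e'⁆)

  r-M'≡r-N-∋e' : ∀ {Y} → e' ∈ Y → r M' Y ≡ r N Y
  r-M'≡r-N-∋e' e'∈Y = trans (r-M'-∋e' e'∈Y) (sym (r-withColoop-∈ M e'∈Y))

  r-M'≡r-N-∌ê : ∀ {Y} → ê ∉ Y → r M' Y ≡ r N Y
  r-M'≡r-N-∌ê {Y} ê∉Y with e' ∈? Y
  ... | yes e'∈Y = r-M'≡r-N-∋e' e'∈Y
  ... | no  e'∉Y = suc-injective (begin
    suc (r M' Y)                       ≡⟨ seriesPair-r-∪ʳ M' series (⊆-∁[⁅x⁆∪⁅y⁆] ê∉Y e'∉Y) ⟨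
    r M' (Y ∪ ⁅ e' ⁆)                  ≡⟨ r-M'-∋e' (q⊆p∪q Y _ (x∈⁅x⁆ e')) ⟩
    suc (r M (removeAt (Y ∪ ⁅ e' ⁆) e')) ≡⟨ cong (suc ∘ r M) (removeAt-∪-⁅⁆ Y e') ⟩
    suc (r M (removeAt Y e'))          ≡⟨ cong suc (r-withColoop-∉ M e'∉Y) ⟨
    suc (r N Y)                        ∎)
    where open ≡-Reasoning

  r-M'-∋ê : ∀ {Y} → ê ∈ Y → r M' Y ≡ principalRank N F true (Y [ ê ]≔ false)
  r-M'-∋ê {Y} ê∈Y = ≤-antisym (⊓-glb r-Y≤suc-r-Y₀ r-Y≤r-Y₀∪F) lower-bound
    where
    open ≤-Reasoning
    Y₀ = Y [ ê ]≔ false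

    ê∉Y₀ : ê ∉ Y₀
    ê∉Y₀ = ∉-[]≔false Y ê

    r-Y≤suc-r-Y₀ : r M' Y ≤ suc (r N Y₀)
    r-Y≤suc-r-Y₀ = ≤-trans (r-≤-suc M' (⊆-[]≔false-∪ Y ê)) (s≤s (≤-reflexive (r-M'≡r-N-∌ê ê∉Y₀)))

    r-M'-[Y∪e'] : r M' (Y ∪ ⁅ e' ⁆) ≡ r N (Y₀ ∪ F)
    r-M'-[Y∪e'] = begin-equality
      r M' (Y ∪ ⁅ e' ⁆)               ≡⟨ r-M'≡r-N-∋e' (q⊆p∪q Y _ (x∈⁅x⁆ e')) ⟩
      r N (Y ∪ ⁅ e' ⁆)                ≡⟨ cong (r N) (⊆-antisym Y∪e'⊆ ⊆Y∪e') ⟩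
      r N (Y₀ ∪ (⁅ ê ⁆ ∪ ⁅ e' ⁆))     ≡⟨ Closure.r-∪-cl N (⁅ ê ⁆ ∪ ⁅ e' ⁆) Y₀ ⟨
      r N (Y₀ ∪ F)                    ∎
      where
      Y∪e'⊆ : Y ∪ ⁅ e' ⁆ ⊆ Y₀ ∪ (⁅ ê ⁆ ∪ ⁅ e' ⁆)
      Y∪e'⊆ = ∪-lub (⊆-trans (⊆-[]≔false-∪ Y ê) (∪-mono ⊆-refl (p⊆p∪q _))) (⊆-trans (q⊆p∪q ⁅ ê ⁆ _) (q⊆p∪q Y₀ _))
      ⊆Y∪e' : Y₀ ∪ (⁅ ê ⁆ ∪ ⁅ e' ⁆) ⊆ Y ∪ ⁅ e' ⁆
      ⊆Y∪e' = ∪-lub (⊆-trans ([]≔false-⊆ Y ê) (p⊆p∪q _)) (∪-mono (⁅x⁆⊆p ê∈Y) ⊆-refl)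

    r-Y≤r-Y₀∪F : r M' Y ≤ r N (Y₀ ∪ F)
    r-Y≤r-Y₀∪F = ≤-trans (r-mono M' (p⊆p∪q ⁅ e' ⁆)) (≤-reflexive r-M'-[Y∪e'])

    lower-bound : principalRank N F true Y₀ ≤ r M' Y
    lower-bound with e' ∈? Y
    ... | yes e'∈Y = begin
      suc (r N Y₀) ⊓ r N (Y₀ ∪ F)     ≤⟨ m⊓n≤n _ _ ⟩
      r N (Y₀ ∪ F)                    ≡⟨ r-M'-[Y∪e'] ⟨
      r M' (Y ∪ ⁅ e' ⁆)               ≤⟨ r-mono M' (∪-lub ⊆-refl (⁅x⁆⊆p e'∈Y)) ⟩
      r M' Y                          ∎
    ... | no  e'∉Y = begin
      suc (r N Y₀) ⊓ r N (Y₀ ∪ F)     ≤⟨ m⊓n≤m _ _ ⟩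
      suc (r N Y₀)                    ≡⟨ cong suc (r-M'≡r-N-∌ê ê∉Y₀) ⟨
      suc (r M' Y₀)                   ≡⟨ seriesPair-r-∪ˡ M' series (⊆-∁[⁅x⁆∪⁅y⁆] ê∉Y₀ (e'∉Y ∘ []≔false-⊆ Y ê)) ⟨
      r M' (Y₀ ∪ ⁅ ê ⁆)               ≤⟨ r-mono M' (∪-lub ([]≔false-⊆ Y ê) (⁅x⁆⊆p ê∈Y)) ⟩
      r M' Y                          ∎

  -- The new element sits at index inject₁ ê, pushing ê itself to suc ê; deleting suc ê leaves
  -- the new element where ê was.
  N⁺ : Matroid (suc (suc n))
  N⁺ = principalExtension N F (inject₁ ê)

  M'-isDeletion : IsDeletion N⁺ (suc ê) M'
  M'-isDeletion Y
    rewrite lookup-insertAt-suc-inject₁ Y ê false | removeAt-inject₁-insertAt-suc Y ê false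
    with lookup Y ê in Y[ê]
  ... | true  = r-M'-∋ê (lookup⇒[]= ê Y Y[ê])
  ... | false = trans (r-M'≡r-N-∌ê (lookup≡false⇒∉ Y[ê])) (cong (r N) (sym Y[ê]≔false≡Y))
    where
    Y[ê]≔false≡Y : Y [ ê ]≔ false ≡ Y
    Y[ê]≔false≡Y = trans (cong (Y [ ê ]≔_) (sym Y[ê])) ([]≔-lookup Y ê)

lemma3p1 : ∀ {n} (M : Matroid n) (e : Fin n) (e' : Fin (suc n)) (M' : Matroid (suc n)) →
           IsSeriesExtension M e e' M' → Constructed M M'
lemma3p1 M e e' M' (M'/e'≈M , series) =
  delete (suc ê) M' (principal F (inject₁ ê) N⁺ N-constructed N⁺-isPrincipal) M'-isDeletion
  where
  open SeriesExtension M e e' M' M'/e'≈M series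

  N-constructed : Constructed M N
  N-constructed = addColoop e' N start (withColoop-isColoopExtension M e')

  N⁺-isPrincipal : IsPrincipalExtension N F (inject₁ ê) N⁺
  N⁺-isPrincipal = principalExtension-isPrincipalExtension N F (inject₁ ê) (Closure.cl-isFlat N (⁅ ê ⁆ ∪ ⁅ e' ⁆))
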